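{- If a $(v,[k_1,k_2,k_3],\lambda)$ Hadamard partitioned difference family exists, then no prime divisor of $(2k_1+1)(2k_2+1)(2k_3+1)$ is congruent to $5$ modulo $6$.
   Context: Groups are finite, written additively (not necessarily abelian). For $B\subseteq G$, $\Delta B=\{x-y: x,y\in B, x\neq y\}$ as a multiset. A $(v,[k_1,\dots,k_t],\lambda)$ partitioned difference family (PDF) is a partition of a group $G$ of order $v$ into blocks $B_1,\dots,B_t$ with $|B_i|=k_i$ such that the multiset union of the $\Delta B_i$ covers every non-zero element of $G$ exactly $\lambda$ times. It is Hadamard (HPDF) if $v=2\lambda$. -}

module Defs where

open import Data.Nat using (ℕ; _≤_; _*_; _+_)
open import Data.Fin using (Fin)
open import Data.Fin.Properties using (_≟_)
open import Data.List using (List; length; filter; allFin; cartesianProduct)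
open import Data.Product using (_×_; _,_; proj₁; proj₂; Σ)
open import Relation.Nullary using (¬_; ¬?)
open import Relation.Nullary.Decidable using (_×-dec_)
open import Relation.Unary using (Pred; Decidable)
open import Relation.Binary.PropositionalEquality using (_≡_)
open import Algebra.Structures using (IsGroup)
open import Level using (0ℓ)

-- A finite group of order v, written additively, with carrier Fin v
-- (any finite group of order v is isomorphic to one of this form).
record FinGroup (v : ℕ) : Set where
  field
    _⊕_  : Fin v → Fin v → Fin v
    𝟘    : Fin v
    ⊖_   : Fin v → Fin v
    isGroup : IsGroup _≡_ _⊕_ 𝟘 ⊖_

  _⊝_ : Fin v → Fin v → Fin v
  x ⊝ y = x ⊕ (⊖ y)

count : ∀ {v} {P : Pred (Fin v) 0ℓ} → Decidable P → ℕ
count {v} P? = length (filter P? (allFin v))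

count₂ : ∀ {v} {P : Pred (Fin v × Fin v) 0ℓ} → Decidable P → ℕ
count₂ {v} P? = length (filter P? (cartesianProduct (allFin v) (allFin v)))

-- A (v, [k_1,...,k_t], λ) partitioned difference family in the group G:
-- the partition into blocks B_1..B_t is given by the block-index map
-- blk : G → Fin t (B_i = blk⁻¹(i)); blocks are nonempty (partition)
-- and |B_i| = k_i; every nonzero g occurs exactly λ times in the
-- multiset union of the ΔB_i, i.e. the number of ordered pairs (x,y)
-- with x ≠ y, x,y in a common block and x - y = g equals λ.
record IsPDF {v : ℕ} (G : FinGroup v) (t : ℕ) (k : Fin t → ℕ) (λ' : ℕ)
             (blk : Fin v → Fin t) : Set where
  open FinGroup G
  field
    nonempty : ∀ i → 1 ≤ k i
    sizes    : ∀ i → count (λ x → blk x ≟ i) ≡ k i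
    diffs    : ∀ g → ¬ (g ≡ 𝟘) →
               count₂ (λ (p : Fin v × Fin v) →
                  (¬? (proj₁ p ≟ proj₂ p) ×-dec
                   (blk (proj₁ p) ≟ blk (proj₂ p))) ×-dec
                  ((proj₁ p ⊝ proj₂ p) ≟ g)) ≡ λ'

PDF : (v t : ℕ) (k : Fin t → ℕ) (λ' : ℕ) → Set
PDF v t k λ' = Σ (FinGroup v) λ G → Σ (Fin v → Fin t) λ blk → IsPDF G t k λ' blk

HPDF : (v t : ℕ) (k : Fin t → ℕ) (λ' : ℕ) → Set
HPDF v t k λ' = PDF v t k λ' × (v ≡ 2 * λ')

module Submission where

-- Counting ordered pairs inside the blocks gives Σ kᵢ = v and Σ kᵢ(kᵢ − 1) = λ(v − 1);
-- when v = 2λ this becomes 2(a² + b² + c²) = s² + s for block sizes a, b, c and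
-- s = a + b + c. That identity turns the product of any two of 2a + 1, 2b + 1, 2c + 1
-- into n² + n + 1 for a natural number n, and a prime p ≡ 5 (mod 6) divides no such
-- number: n³ ≡ 1 (mod p), and since p ≡ 2 (mod 3) Fermat's n^p ≡ n gives n² ≡ n,
-- so n ≡ 1 and p ∣ 3.

module BinomialCoefficients where

  open import Data.Nat using (zero; suc; _+_; _*_; _<_)
  open import Data.Nat.Properties using (*-zeroʳ; *-identityˡ; *-identityʳ; *-distribˡ-+; *-comm; <⇒≱)
  open import Data.Nat.Divisibility using (_∣_; divides; ∣⇒≤)
  open import Data.Nat.Primality using (Prime; euclidsLemma)
  open import Data.Nat.Combinatorics using (_C_; nC1≡n; nCk+nC[k+1]≡[n+1]C[k+1])
  open import Data.Nat.Tactic.RingSolver using (solve-∀)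
  open import Data.Sum using (inj₁; inj₂)
  open import Data.Empty using (⊥-elim)
  open import Relation.Binary.PropositionalEquality

  [k+1]*[n+1]C[k+1]≡[n+1]*nCk : ∀ n k → suc k * (suc n C suc k) ≡ suc n * (n C k)
  [k+1]*[n+1]C[k+1]≡[n+1]*nCk zero    zero    = refl
  [k+1]*[n+1]C[k+1]≡[n+1]*nCk zero    (suc k) = *-zeroʳ (suc (suc k))
  [k+1]*[n+1]C[k+1]≡[n+1]*nCk (suc n) zero    = begin
    1 * (suc (suc n) C 1) ≡⟨ *-identityˡ _ ⟩
    suc (suc n) C 1       ≡⟨ nC1≡n (suc (suc n)) ⟩
    suc (suc n)           ≡⟨ *-identityʳ (suc (suc n)) ⟨
    suc (suc n) * 1       ∎
    where open ≡-Reasoning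
  [k+1]*[n+1]C[k+1]≡[n+1]*nCk (suc n) (suc k) = begin
    suc (suc k) * (suc (suc n) C suc (suc k))
      ≡⟨ cong (suc (suc k) *_) (nCk+nC[k+1]≡[n+1]C[k+1] (suc n) (suc k)) ⟨
    suc (suc k) * (A + B)
      ≡⟨ regroup (suc k) A B ⟩
    A + (suc k * A + suc (suc k) * B)
      ≡⟨ cong₂ (λ u w → A + (u + w)) ([k+1]*[n+1]C[k+1]≡[n+1]*nCk n k) ([k+1]*[n+1]C[k+1]≡[n+1]*nCk n (suc k)) ⟩
    A + (suc n * (n C k) + suc n * (n C suc k))
      ≡⟨ cong (A +_) (*-distribˡ-+ (suc n) (n C k) (n C suc k)) ⟨
    A + suc n * (n C k + n C suc k)
      ≡⟨ cong (λ u → A + suc n * u) (nCk+nC[k+1]≡[n+1]C[k+1] n k) ⟩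
    suc (suc n) * A ∎
    where
    open ≡-Reasoning
    A = suc n C suc k
    B = suc n C suc (suc k)
    regroup : ∀ k a b → suc k * (a + b) ≡ a + (k * a + suc k * b)
    regroup = solve-∀

  prime∣pCk : ∀ {p k} → Prime p → 0 < k → k < p → p ∣ p C k
  prime∣pCk {suc m} {suc j} pr _ j<m
    with euclidsLemma (suc j) (suc m C suc j) pr
           (divides (m C j) (trans ([k+1]*[n+1]C[k+1]≡[n+1]*nCk m j) (*-comm (suc m) (m C j))))
  ... | inj₁ p∣k = ⊥-elim (<⇒≱ j<m (∣⇒≤ p∣k))
  ... | inj₂ p∣C = p∣C

module ModularArithmetic where

  open import Data.Nat as ℕ using (ℕ; zero; suc; _%_; _/_)
  import Data.Nat.Properties as ℕ
  open import Data.Nat.DivMod using (m≡m%n+[m/n]*n; m%n≤m)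
  import Data.Nat.Divisibility as ℕ
  open import Data.Nat.Primality using (Prime; ¬prime[0])
  open import Data.Nat.Combinatorics using (_C_; nCn≡1)
  import Data.Nat.Tactic.RingSolver as ℕSolver
  open import Data.Integer using (ℤ; +_; -_; 0ℤ; 1ℤ; _+_; _*_; _-_; _^_)
  import Data.Integer.Properties as ℤ
  open import Data.Integer.Divisibility.Signed
  open import Data.Integer.Tactic.RingSolver using (solve-∀)
  open import Data.Fin as Fin using (Fin; fromℕ; inject₁; toℕ)
  open import Data.Fin.Properties using (toℕ-fromℕ; toℕ-inject₁; toℕ<n)
  open import Data.Empty using (⊥-elim)
  open import Function using (_∘_)
  open import Relation.Binary.Bundles using (Setoid)
  open import Relation.Binary.Structures using (IsEquivalence)
  open import Relation.Binary.PropositionalEquality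
  import Relation.Binary.Reasoning.Setoid as SetoidReasoning
  import Algebra.Properties.CommutativeSemiring.Binomial as Binomial
  import Algebra.Properties.Monoid.Sum as MonoidSum
  import Algebra.Properties.Semiring.Exp as SemiringExp
  import Algebra.Properties.Semiring.Mult as SemiringMult
  open BinomialCoefficients using (prime∣pCk)

  infix 4 _≡_mod_

  record _≡_mod_ (a b : ℤ) (n : ℕ) : Set where
    constructor ≡-mod
    field
      ∣-difference : + n ∣ a - b

  module _ {n : ℕ} where

    ∣-resp-≡ : ∀ {a b} → a ≡ b → + n ∣ a → + n ∣ b
    ∣-resp-≡ = subst (+ n ∣_)

    ≡-mod-refl : ∀ {a} → a ≡ a mod n
    ≡-mod-refl {a} = ≡-mod (∣-resp-≡ (sym (ℤ.+-inverseʳ a)) (divides 0ℤ refl))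

    ≡-mod-sym : ∀ {a b} → a ≡ b mod n → b ≡ a mod n
    ≡-mod-sym {a} {b} (≡-mod h) = ≡-mod (∣-resp-≡ (neg[a-b] a b) (∣m⇒∣-m h))
      where
      neg[a-b] : ∀ a b → - (a - b) ≡ b - a
      neg[a-b] = solve-∀

    ≡-mod-trans : ∀ {a b c} → a ≡ b mod n → b ≡ c mod n → a ≡ c mod n
    ≡-mod-trans {a} {b} {c} (≡-mod h) (≡-mod k) = ≡-mod (∣-resp-≡ (a-b+b-c a b c) (∣m∣n⇒∣m+n h k))
      where
      a-b+b-c : ∀ a b c → (a - b) + (b - c) ≡ a - c
      a-b+b-c = solve-∀

    ≡-mod-isEquivalence : IsEquivalence (λ a b → a ≡ b mod n)
    ≡-mod-isEquivalence = record { refl = ≡-mod-refl ; sym = ≡-mod-sym ; trans = ≡-mod-trans }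

    ≡-mod-setoid : Setoid _ _
    ≡-mod-setoid = record { isEquivalence = ≡-mod-isEquivalence }

    module ≡-mod-Reasoning = SetoidReasoning ≡-mod-setoid

    +-cong-mod : ∀ {a b c d} → a ≡ b mod n → c ≡ d mod n → a + c ≡ b + d mod n
    +-cong-mod {a} {b} {c} {d} (≡-mod h) (≡-mod k) = ≡-mod (∣-resp-≡ (regroup a b c d) (∣m∣n⇒∣m+n h k))
      where
      regroup : ∀ a b c d → (a - b) + (c - d) ≡ (a + c) - (b + d)
      regroup = solve-∀

    *-cong-mod : ∀ {a b c d} → a ≡ b mod n → c ≡ d mod n → a * c ≡ b * d mod n
    *-cong-mod {a} {b} {c} {d} (≡-mod h) (≡-mod k) =
      ≡-mod (∣-resp-≡ (regroup a b c d) (∣m∣n⇒∣m+n (∣m⇒∣m*n c h) (∣n⇒∣m*n b k)))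
      where
      regroup : ∀ a b c d → (a - b) * c + b * (c - d) ≡ a * c - b * d
      regroup = solve-∀

    ^-cong-mod : ∀ {a b} m → a ≡ b mod n → a ^ m ≡ b ^ m mod n
    ^-cong-mod zero    h = ≡-mod-refl
    ^-cong-mod (suc m) h = *-cong-mod h (^-cong-mod m h)

    ∣⇒≡0-mod : ∀ {a} → + n ∣ a → a ≡ 0ℤ mod n
    ∣⇒≡0-mod {a} h = ≡-mod (∣-resp-≡ (sym (ℤ.+-identityʳ a)) h)

    ≡0-mod⇒∣ : ∀ {a} → a ≡ 0ℤ mod n → + n ∣ a
    ≡0-mod⇒∣ {a} (≡-mod h) = ∣-resp-≡ (ℤ.+-identityʳ a) h

    +-∣⇒≡-mod : ∀ a {b} → + n ∣ b → a + b ≡ a mod n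
    +-∣⇒≡-mod a {b} h = ≡-mod (∣-resp-≡ (a+b-a a b) h)
      where
      a+b-a : ∀ a b → b ≡ a + b - a
      a+b-a = solve-∀

    ≡⇒≡-mod : ∀ {a b} → a ≡ b → a ≡ b mod n
    ≡⇒≡-mod refl = ≡-mod-refl

    +-congˡ-mod : ∀ a {b c} → b ≡ c mod n → a + b ≡ a + c mod n
    +-congˡ-mod a = +-cong-mod (≡-mod-refl {a})

    *-congˡ-mod : ∀ a {b c} → b ≡ c mod n → a * b ≡ a * c mod n
    *-congˡ-mod a = *-cong-mod (≡-mod-refl {a})

    *-congʳ-mod : ∀ a {b c} → b ≡ c mod n → b * a ≡ c * a mod n
    *-congʳ-mod a h = *-cong-mod h (≡-mod-refl {a})

  module B = Binomial ℤ.+-*-commutativeSemiring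
  module Σ = MonoidSum ℤ.+-0-monoid
  module E = SemiringExp ℤ.+-*-semiring
  module M = SemiringMult ℤ.+-*-semiring

  ^ᴱ≡^ : ∀ x n → x E.^ n ≡ x ^ n
  ^ᴱ≡^ x zero    = refl
  ^ᴱ≡^ x (suc n) = cong (x *_) (^ᴱ≡^ x n)

  ×≡* : ∀ n x → n M.× x ≡ + n * x
  ×≡* zero    x = sym (ℤ.*-zeroˡ x)
  ×≡* (suc n) x = begin
    x + n M.× x       ≡⟨ cong (λ u → x + u) (×≡* n x) ⟩
    x + + n * x       ≡⟨ cong (_+ + n * x) (ℤ.*-identityˡ x) ⟨
    1ℤ * x + + n * x  ≡⟨ ℤ.*-distribʳ-+ x 1ℤ (+ n) ⟨
    + suc n * x       ∎
    where open ≡-Reasoning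

  module _ (x y : ℤ) (m : ℕ) where

    binomialTerm-first : B.binomialTerm x y (suc m) Fin.zero ≡ y ^ suc m
    binomialTerm-first = begin
      1 M.× (1ℤ * y E.^ suc m) ≡⟨ ×≡* 1 _ ⟩
      1ℤ * (1ℤ * y E.^ suc m)  ≡⟨ trans (ℤ.*-identityˡ _) (ℤ.*-identityˡ _) ⟩
      y E.^ suc m              ≡⟨ ^ᴱ≡^ y (suc m) ⟩
      y ^ suc m                ∎
      where open ≡-Reasoning

    binomialTerm-last : B.binomialTerm x y (suc m) (fromℕ (suc m)) ≡ x ^ suc m
    binomialTerm-last = begin
      B.binomialTerm x y (suc m) (fromℕ (suc m))
        ≡⟨ cong (λ j → (suc m C suc j) M.× (x E.^ suc j * y E.^ (m ℕ.∸ j))) (toℕ-fromℕ m) ⟩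
      (suc m C suc m) M.× (x E.^ suc m * y E.^ (m ℕ.∸ m))
        ≡⟨ cong₂ (λ c e → c M.× (x E.^ suc m * y E.^ e)) (nCn≡1 (suc m)) (ℕ.n∸n≡0 m) ⟩
      1 M.× (x E.^ suc m * 1ℤ)
        ≡⟨ trans (×≡* 1 _) (trans (ℤ.*-identityˡ _) (ℤ.*-identityʳ _)) ⟩
      x E.^ suc m
        ≡⟨ ^ᴱ≡^ x (suc m) ⟩
      x ^ suc m ∎
      where open ≡-Reasoning

    prime∣binomialTerm : Prime (suc m) → ∀ i → + suc m ∣ B.binomialTerm x y (suc m) (Fin.suc (inject₁ i))
    prime∣binomialTerm pr i = subst (+ suc m ∣_) (sym (×≡* (suc m C suc j) b))
      (∣m⇒∣m*n b (∣ᵤ⇒∣ {i = + (suc m C suc j)} (prime∣pCk pr (ℕ.s≤s ℕ.z≤n) (ℕ.s≤s (subst (ℕ._< m) (sym (toℕ-inject₁ i)) (toℕ<n i))))))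
      where
      j = toℕ (inject₁ i)
      b = B.binomial x y (suc m) (Fin.suc (inject₁ i))

  ∣-sum : ∀ {d n} (f : Fin n → ℤ) → (∀ i → d ∣ f i) → d ∣ Σ.sum f
  ∣-sum {n = zero}  f _ = divides 0ℤ refl
  ∣-sum {n = suc n} f h = ∣m∣n⇒∣m+n (h Fin.zero) (∣-sum (f ∘ Fin.suc) (h ∘ Fin.suc))

  freshman's-dream : ∀ {p} → Prime p → ∀ x y → (x + y) ^ p ≡ x ^ p + y ^ p mod p
  freshman's-dream {zero}  pr = ⊥-elim (¬prime[0] pr)
  freshman's-dream {suc m} pr x y = begin
    (x + y) ^ suc m
      ≡⟨ ^ᴱ≡^ (x + y) (suc m) ⟨
    (x + y) E.^ suc m
      ≡⟨ B.theorem (suc m) x y ⟩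
    t Fin.zero + Σ.sum (t ∘ Fin.suc)
      ≡⟨ cong (λ u → t Fin.zero + u) (Σ.sum-init-last (t ∘ Fin.suc)) ⟩
    t Fin.zero + (Σ.sum (t ∘ Fin.suc ∘ inject₁) + t (Fin.suc (fromℕ m)))
      ≡⟨ regroup (t Fin.zero) _ (t (Fin.suc (fromℕ m))) ⟩
    (t Fin.zero + t (Fin.suc (fromℕ m))) + Σ.sum (t ∘ Fin.suc ∘ inject₁)
      ≈⟨ +-∣⇒≡-mod (t Fin.zero + t (Fin.suc (fromℕ m))) (∣-sum _ (prime∣binomialTerm x y m pr)) ⟩
    t Fin.zero + t (Fin.suc (fromℕ m))
      ≡⟨ cong₂ _+_ (binomialTerm-first x y m) (binomialTerm-last x y m) ⟩
    y ^ suc m + x ^ suc m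
      ≡⟨ ℤ.+-comm (y ^ suc m) (x ^ suc m) ⟩
    x ^ suc m + y ^ suc m ∎
    where
    open ≡-mod-Reasoning
    regroup : ∀ a b c → a + (b + c) ≡ (a + c) + b
    regroup = solve-∀
    t = B.binomialTerm x y (suc m)

  fermat's-little-theorem : ∀ {p} → Prime p → ∀ w → (+ w) ^ p ≡ + w mod p
  fermat's-little-theorem {zero}  pr _       = ⊥-elim (¬prime[0] pr)
  fermat's-little-theorem {suc m} pr zero    = ≡⇒≡-mod (ℤ.*-zeroˡ (0ℤ ^ m))
  fermat's-little-theorem {suc m} pr (suc w) = begin
    (1ℤ + + w) ^ suc m          ≈⟨ freshman's-dream pr 1ℤ (+ w) ⟩
    1ℤ ^ suc m + (+ w) ^ suc m  ≈⟨ +-cong-mod (≡⇒≡-mod (ℤ.^-zeroˡ (suc m))) (fermat's-little-theorem pr w) ⟩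
    1ℤ + + w                    ∎
    where open ≡-mod-Reasoning

  ∣z²+z+1⇒z³≡1 : ∀ {n} z → + n ∣ z * z + z + 1ℤ → z ^ 3 ≡ 1ℤ mod n
  ∣z²+z+1⇒z³≡1 {n} z n∣ = begin
    z ^ 3                             ≡⟨ factor z ⟩
    1ℤ + (z - 1ℤ) * (z * z + z + 1ℤ)  ≈⟨ +-congˡ-mod 1ℤ (*-congˡ-mod (z - 1ℤ) (∣⇒≡0-mod n∣)) ⟩
    1ℤ + (z - 1ℤ) * 0ℤ                ≡⟨ drop z ⟩
    1ℤ                                ∎
    where
    open ≡-mod-Reasoning
    factor : ∀ z → z * (z * (z * 1ℤ)) ≡ 1ℤ + (z - 1ℤ) * (z * z + z + 1ℤ)
    factor = solve-∀
    drop : ∀ z → 1ℤ + (z - 1ℤ) * 0ℤ ≡ 1ℤ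
    drop = solve-∀

  z³≡1⇒z^[3q+r]≡z^r : ∀ {n z} → z ^ 3 ≡ 1ℤ mod n → ∀ q r → z ^ (3 ℕ.* q ℕ.+ r) ≡ z ^ r mod n
  z³≡1⇒z^[3q+r]≡z^r {n} {z} z³≡1 q r = begin
    z ^ (3 ℕ.* q ℕ.+ r)   ≡⟨ ℤ.^-distribˡ-+-* z (3 ℕ.* q) r ⟩
    z ^ (3 ℕ.* q) * z ^ r ≡⟨ cong (_* z ^ r) (ℤ.^-*-assoc z 3 q) ⟨
    (z ^ 3) ^ q * z ^ r   ≈⟨ *-congʳ-mod (z ^ r) (^-cong-mod q z³≡1) ⟩
    1ℤ ^ q * z ^ r        ≡⟨ cong (_* z ^ r) (ℤ.^-zeroˡ q) ⟩
    1ℤ * z ^ r            ≡⟨ ℤ.*-identityˡ (z ^ r) ⟩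
    z ^ r                 ∎
    where open ≡-mod-Reasoning

  p∣n²+n+1⇒p%6≢5 : ∀ {p n} → Prime p → p ℕ.∣ n ℕ.* n ℕ.+ n ℕ.+ 1 → p % 6 ≢ 5
  p∣n²+n+1⇒p%6≢5 {p} {n} pr p∣ p%6≡5 = ℕ.<⇒≱ 3<p (ℕ.∣⇒≤ p∣3)
    where
    z = + n
    p∣z²+z+1 : + p ∣ z * z + z + 1ℤ
    p∣z²+z+1 = subst (+ p ∣_) cast (∣ᵤ⇒∣ p∣)
      where
      cast : + (n ℕ.* n ℕ.+ n ℕ.+ 1) ≡ z * z + z + 1ℤ
      cast = trans (ℤ.pos-+ (n ℕ.* n ℕ.+ n) 1) (cong (_+ 1ℤ) (trans (ℤ.pos-+ (n ℕ.* n) n) (cong (_+ z) (ℤ.pos-* n n))))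
    3<p : 3 ℕ.< p
    3<p = ℕ.≤-trans (ℕ.n≤1+n 4) (subst (ℕ._≤ p) p%6≡5 (m%n≤m p 6))
    z³≡1 : z ^ 3 ≡ 1ℤ mod p
    z³≡1 = ∣z²+z+1⇒z³≡1 z p∣z²+z+1
    p≡3[2q+1]+2 : p ≡ 3 ℕ.* (2 ℕ.* (p / 6) ℕ.+ 1) ℕ.+ 2
    p≡3[2q+1]+2 = trans (m≡m%n+[m/n]*n p 6) (trans (cong (ℕ._+ (p / 6) ℕ.* 6) p%6≡5) (regroup (p / 6)))
      where
      regroup : ∀ q → 5 ℕ.+ q ℕ.* 6 ≡ 3 ℕ.* (2 ℕ.* q ℕ.+ 1) ℕ.+ 2
      regroup = ℕSolver.solve-∀
    z²≡z : z * z ≡ z mod p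
    z²≡z = begin
      z * z                                    ≡⟨ cong (z *_) (ℤ.*-identityʳ z) ⟨
      z ^ 2                                    ≈⟨ z³≡1⇒z^[3q+r]≡z^r z³≡1 (2 ℕ.* (p / 6) ℕ.+ 1) 2 ⟨
      z ^ (3 ℕ.* (2 ℕ.* (p / 6) ℕ.+ 1) ℕ.+ 2)  ≡⟨ cong (z ^_) p≡3[2q+1]+2 ⟨
      z ^ p                                    ≈⟨ fermat's-little-theorem pr n ⟩
      z                                        ∎
      where open ≡-mod-Reasoning
    z≡1 : z ≡ 1ℤ mod p
    z≡1 = begin
      z                   ≈⟨ z²≡z ⟨
      z * z               ≈⟨ *-congˡ-mod z z²≡z ⟨
      z * (z * z)         ≡⟨ cong (λ u → z * (z * u)) (ℤ.*-identityʳ z) ⟨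
      z ^ 3               ≈⟨ z³≡1 ⟩
      1ℤ                  ∎
      where open ≡-mod-Reasoning
    3≡0 : + 3 ≡ 0ℤ mod p
    3≡0 = begin
      1ℤ * 1ℤ + 1ℤ + 1ℤ   ≈⟨ +-cong-mod (+-cong-mod (*-cong-mod z≡1 z≡1) z≡1) (≡-mod-refl {a = 1ℤ}) ⟨
      z * z + z + 1ℤ      ≈⟨ ∣⇒≡0-mod p∣z²+z+1 ⟩
      0ℤ                  ∎
      where open ≡-mod-Reasoning
    p∣3 : p ℕ.∣ 3
    p∣3 = ∣⇒∣ᵤ (≡0-mod⇒∣ 3≡0)

open import Defs
open import Data.Nat using (ℕ; zero; suc; _+_; _*_; _∸_; _%_)
open import Data.Nat.Properties
  using (+-0-commutativeMonoid; +-*-semiring; *-identityʳ; *-zeroʳ; *-distribˡ-+; +-assoc; +-comm;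
         +-cancelʳ-≡; ≤-<-connex; m+[n∸m]≡n)
open import Data.Nat.Divisibility using (_∣_; ∣n⇒∣m*n)
open import Data.Nat.Primality using (Prime; euclidsLemma)
open import Data.Nat.Tactic.RingSolver using (solve-∀)
open import Data.Fin using (Fin; zero; suc)
open import Data.Fin.Properties using (_≟_; suc-injective)
open import Data.Vec using (lookup; _∷_; [])
open import Data.List using (List; []; _∷_; length; filter; tabulate; allFin; map; cartesianProduct; _++_)
open import Data.List.Properties using (filter-++; length-++)
open import Data.Bool using (if_then_else_)
open import Data.Product using (_×_; _,_; proj₁; proj₂; ∃-syntax)
open import Data.Sum using (inj₁; inj₂)
open import Function using (_∘_)
open import Level using (Level; 0ℓ)
open import Relation.Nullary using (Dec; does; yes; no; ¬_; ¬?)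
open import Relation.Nullary.Decidable using (_×-dec_)
open import Relation.Nullary.Negation using (contradiction)
open import Relation.Unary using (Pred; Decidable)
open import Relation.Binary.PropositionalEquality
open import Algebra.Bundles using (Group)
open import Algebra.Properties.Group using (x∙y⁻¹≈ε⇒x≈y)
open import Algebra.Properties.Semiring.Sum +-*-semiring using (*-distribˡ-sum; *-distribʳ-sum)
open import Algebra.Properties.CommutativeMonoid.Sum +-0-commutativeMonoid
  using (sum-syntax; sum-cong-≗; ∑-comm; ∑-distrib-+)
open ModularArithmetic using (p∣n²+n+1⇒p%6≢5)

private
  variable
    a ℓ : Level
    A B : Set a
    n : ℕ

-- Indicator sums

-- Defined through `does` so that 𝟙 (suc c ≟ suc i) reduces to 𝟙 (c ≟ i).
𝟙 : {P : Set ℓ} → Dec P → ℕ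
𝟙 P? = if does P? then 1 else 0

𝟙-× : {P Q : Set ℓ} (P? : Dec P) (Q? : Dec Q) → 𝟙 (P? ×-dec Q?) ≡ 𝟙 P? * 𝟙 Q?
𝟙-× (yes _) (yes _) = refl
𝟙-× (yes _) (no _)  = refl
𝟙-× (no _)  _       = refl

𝟙-⇔ : {P Q : Set ℓ} (P? : Dec P) (Q? : Dec Q) → (P → Q) → (Q → P) → 𝟙 P? ≡ 𝟙 Q?
𝟙-⇔ (yes _) (yes _) _   _   = refl
𝟙-⇔ (yes p) (no ¬q) P⇒Q _   = contradiction (P⇒Q p) ¬q
𝟙-⇔ (no ¬p) (yes q) _   Q⇒P = contradiction (Q⇒P q) ¬p
𝟙-⇔ (no _)  (no _)  _   _   = refl

𝟙-no : {P : Set ℓ} (P? : Dec P) → ¬ P → 𝟙 P? ≡ 0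
𝟙-no (yes p) ¬p = contradiction p ¬p
𝟙-no (no _)  _  = refl

𝟙-split : {P Q : Set ℓ} (P? : Dec P) (Q? : Dec Q) → 𝟙 Q? ≡ 𝟙 (¬? P? ×-dec Q?) + 𝟙 (P? ×-dec Q?)
𝟙-split (yes _) Q?      = refl
𝟙-split (no _)  (yes _) = refl
𝟙-split (no _)  (no _)  = refl

∑-const : ∀ n m → ∑[ i < n ] m ≡ n * m
∑-const zero    m = refl
∑-const (suc n) m = cong (m +_) (∑-const n m)

∑-0 : ∀ n → ∑[ i < n ] 0 ≡ 0
∑-0 n = trans (∑-const n 0) (*-zeroʳ n)

∑-𝟙-≟ : (c : Fin n) → ∑[ i < n ] 𝟙 (c ≟ i) ≡ 1
∑-𝟙-≟ {suc n} zero    = cong suc (∑-0 n)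
∑-𝟙-≟ {suc n} (suc c) = ∑-𝟙-≟ c

∑-𝟙-≟-*-𝟙-≟ : (a b : Fin n) → ∑[ i < n ] (𝟙 (a ≟ i) * 𝟙 (b ≟ i)) ≡ 𝟙 (a ≟ b)
∑-𝟙-≟-*-𝟙-≟ {n} a b = begin
  ∑[ i < n ] (𝟙 (a ≟ i) * 𝟙 (b ≟ i))  ≡⟨ sum-cong-≗ factor ⟩
  ∑[ i < n ] (𝟙 (a ≟ b) * 𝟙 (a ≟ i))  ≡⟨ *-distribˡ-sum (𝟙 (a ≟ b)) (λ i → 𝟙 (a ≟ i)) ⟨
  𝟙 (a ≟ b) * ∑[ i < n ] 𝟙 (a ≟ i)    ≡⟨ cong (𝟙 (a ≟ b) *_) (∑-𝟙-≟ a) ⟩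
  𝟙 (a ≟ b) * 1                       ≡⟨ *-identityʳ (𝟙 (a ≟ b)) ⟩
  𝟙 (a ≟ b)                           ∎
  where
  open ≡-Reasoning
  factor : ∀ i → 𝟙 (a ≟ i) * 𝟙 (b ≟ i) ≡ 𝟙 (a ≟ b) * 𝟙 (a ≟ i)
  factor i = begin
    𝟙 (a ≟ i) * 𝟙 (b ≟ i)      ≡⟨ 𝟙-× (a ≟ i) (b ≟ i) ⟨
    𝟙 ((a ≟ i) ×-dec (b ≟ i))  ≡⟨ 𝟙-⇔ ((a ≟ i) ×-dec (b ≟ i)) ((a ≟ b) ×-dec (a ≟ i))
                                     (λ { (refl , refl) → refl , refl }) (λ { (refl , refl) → refl , refl }) ⟩
    𝟙 ((a ≟ b) ×-dec (a ≟ i))  ≡⟨ 𝟙-× (a ≟ b) (a ≟ i) ⟩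
    𝟙 (a ≟ b) * 𝟙 (a ≟ i)      ∎

∑-const-except-zero-at : ∀ {m} (c : Fin n) (f : Fin n → ℕ) → f c ≡ 0 → (∀ i → i ≢ c → f i ≡ m) →
                         ∑[ i < n ] f i + m ≡ n * m
∑-const-except-zero-at {suc n} {m} zero f f0≡0 f≡m = begin
  f zero + ∑[ i < n ] f (suc i) + m
    ≡⟨ cong₂ (λ a b → a + b + m) f0≡0 (trans (sum-cong-≗ (λ i → f≡m (suc i) λ ())) (∑-const n m)) ⟩
  n * m + m
    ≡⟨ +-comm (n * m) m ⟩
  m + n * m ∎
  where open ≡-Reasoning
∑-const-except-zero-at {suc n} {m} (suc c) f fc≡0 f≡m = begin
  f zero + ∑[ i < n ] f (suc i) + m
    ≡⟨ +-assoc (f zero) _ m ⟩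
  f zero + (∑[ i < n ] f (suc i) + m)
    ≡⟨ cong₂ _+_ (f≡m zero λ ()) (∑-const-except-zero-at c (f ∘ suc) fc≡0 (λ i i≢c → f≡m (suc i) (i≢c ∘ suc-injective))) ⟩
  m + n * m ∎
  where open ≡-Reasoning

length-filter-tabulate : {P : Pred A ℓ} (P? : Decidable P) (f : Fin n → A) →
                         length (filter P? (tabulate f)) ≡ ∑[ i < n ] 𝟙 (P? (f i))
length-filter-tabulate {n = zero}  P? f = refl
length-filter-tabulate {n = suc n} P? f with P? (f zero)
... | yes _ = cong suc (length-filter-tabulate P? (f ∘ suc))
... | no  _ = length-filter-tabulate P? (f ∘ suc)

length-filter-map : {P : Pred A ℓ} (P? : Decidable P) (f : B → A) (xs : List B) →
                    length (filter P? (map f xs)) ≡ length (filter (P? ∘ f) xs)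
length-filter-map P? f []       = refl
length-filter-map P? f (x ∷ xs) with P? (f x)
... | yes _ = cong suc (length-filter-map P? f xs)
... | no  _ = length-filter-map P? f xs

length-filter-cartesianProduct :
  {P : Pred (A × B) ℓ} (P? : Decidable P) (f : Fin n → A) (ys : List B) →
  length (filter P? (cartesianProduct (tabulate f) ys)) ≡ ∑[ i < n ] length (filter (λ y → P? (f i , y)) ys)
length-filter-cartesianProduct {n = zero}  P? f ys = refl
length-filter-cartesianProduct {n = suc n} P? f ys = begin
  length (filter P? (row ++ rows))
    ≡⟨ cong length (filter-++ P? row rows) ⟩
  length (filter P? row ++ filter P? rows)
    ≡⟨ length-++ (filter P? row) ⟩
  length (filter P? row) + length (filter P? rows)
    ≡⟨ cong₂ _+_ (length-filter-map P? (f zero ,_) ys) (length-filter-cartesianProduct P? (f ∘ suc) ys) ⟩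
  ∑[ i < suc n ] length (filter (λ y → P? (f i , y)) ys) ∎
  where
  open ≡-Reasoning
  row   = map (f zero ,_) ys
  rows  = cartesianProduct (tabulate (f ∘ suc)) ys

count≡∑𝟙 : ∀ {v} {P : Pred (Fin v) 0ℓ} (P? : Decidable P) → count P? ≡ ∑[ x < v ] 𝟙 (P? x)
count≡∑𝟙 P? = length-filter-tabulate P? (λ x → x)

count₂≡∑∑𝟙 : ∀ {v} {P : Pred (Fin v × Fin v) 0ℓ} (P? : Decidable P) →
             count₂ P? ≡ ∑[ x < v ] ∑[ y < v ] 𝟙 (P? (x , y))
count₂≡∑∑𝟙 {v} P? = trans (length-filter-cartesianProduct P? (λ x → x) (allFin v))
                           (sum-cong-≗ (λ x → length-filter-tabulate (λ y → P? (x , y)) (λ y → y)))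

-- Fibres of a map between finite sets

module _ {v t} (f : Fin v → Fin t) where

  ∑-fibres : ∑[ i < t ] ∑[ x < v ] 𝟙 (f x ≟ i) ≡ v
  ∑-fibres = begin
    ∑[ i < t ] ∑[ x < v ] 𝟙 (f x ≟ i) ≡⟨ ∑-comm (λ x i → 𝟙 (f x ≟ i)) ⟨
    ∑[ x < v ] ∑[ i < t ] 𝟙 (f x ≟ i) ≡⟨ sum-cong-≗ (λ x → ∑-𝟙-≟ (f x)) ⟩
    ∑[ x < v ] 1                      ≡⟨ ∑-const v 1 ⟩
    v * 1                             ≡⟨ *-identityʳ v ⟩
    v                                 ∎
    where open ≡-Reasoning

  ∑-fibres² : ∑[ i < t ] (∑[ x < v ] 𝟙 (f x ≟ i) * ∑[ y < v ] 𝟙 (f y ≟ i)) ≡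
              ∑[ x < v ] ∑[ y < v ] 𝟙 (f x ≟ f y)
  ∑-fibres² = begin
    ∑[ i < t ] (∑[ x < v ] 𝟙 (f x ≟ i) * ∑[ y < v ] 𝟙 (f y ≟ i))
      ≡⟨ sum-cong-≗ (λ i → *-distribʳ-sum (∑[ y < v ] 𝟙 (f y ≟ i)) (λ x → 𝟙 (f x ≟ i))) ⟩
    ∑[ i < t ] ∑[ x < v ] (𝟙 (f x ≟ i) * ∑[ y < v ] 𝟙 (f y ≟ i))
      ≡⟨ sum-cong-≗ (λ i → sum-cong-≗ (λ x → *-distribˡ-sum (𝟙 (f x ≟ i)) (λ y → 𝟙 (f y ≟ i)))) ⟩
    ∑[ i < t ] ∑[ x < v ] ∑[ y < v ] (𝟙 (f x ≟ i) * 𝟙 (f y ≟ i))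
      ≡⟨ ∑-comm (λ x i → ∑[ y < v ] (𝟙 (f x ≟ i) * 𝟙 (f y ≟ i))) ⟨
    ∑[ x < v ] ∑[ i < t ] ∑[ y < v ] (𝟙 (f x ≟ i) * 𝟙 (f y ≟ i))
      ≡⟨ sum-cong-≗ (λ x → ∑-comm (λ i y → 𝟙 (f x ≟ i) * 𝟙 (f y ≟ i))) ⟩
    ∑[ x < v ] ∑[ y < v ] ∑[ i < t ] (𝟙 (f x ≟ i) * 𝟙 (f y ≟ i))
      ≡⟨ sum-cong-≗ (λ x → sum-cong-≗ (λ y → ∑-𝟙-≟-*-𝟙-≟ (f x) (f y))) ⟩
    ∑[ x < v ] ∑[ y < v ] 𝟙 (f x ≟ f y) ∎
    where open ≡-Reasoning

  ∑∑-same-image : ∑[ x < v ] ∑[ y < v ] 𝟙 (f x ≟ f y) ≡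
                  ∑[ x < v ] ∑[ y < v ] 𝟙 (¬? (x ≟ y) ×-dec (f x ≟ f y)) + v
  ∑∑-same-image = begin
    ∑[ x < v ] ∑[ y < v ] 𝟙 (f x ≟ f y)
      ≡⟨ sum-cong-≗ (λ x → sum-cong-≗ (λ y → 𝟙-split (x ≟ y) (f x ≟ f y))) ⟩
    ∑[ x < v ] ∑[ y < v ] (off x y + on x y)
      ≡⟨ sum-cong-≗ (λ x → ∑-distrib-+ (off x) (on x)) ⟩
    ∑[ x < v ] (∑[ y < v ] off x y + ∑[ y < v ] on x y)
      ≡⟨ ∑-distrib-+ (λ x → ∑[ y < v ] off x y) (λ x → ∑[ y < v ] on x y) ⟩
    ∑[ x < v ] ∑[ y < v ] off x y + ∑[ x < v ] ∑[ y < v ] on x y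
      ≡⟨ cong (∑[ x < v ] ∑[ y < v ] off x y +_) diagonal ⟩
    ∑[ x < v ] ∑[ y < v ] off x y + v ∎
    where
    open ≡-Reasoning
    off on : Fin v → Fin v → ℕ
    off x y = 𝟙 (¬? (x ≟ y) ×-dec (f x ≟ f y))
    on  x y = 𝟙 ((x ≟ y) ×-dec (f x ≟ f y))
    diagonal : ∑[ x < v ] ∑[ y < v ] on x y ≡ v
    diagonal = begin
      ∑[ x < v ] ∑[ y < v ] on x y
        ≡⟨ sum-cong-≗ (λ x → sum-cong-≗ (λ y →
             𝟙-⇔ ((x ≟ y) ×-dec (f x ≟ f y)) (x ≟ y) proj₁ (λ { refl → refl , refl }))) ⟩
      ∑[ x < v ] ∑[ y < v ] 𝟙 (x ≟ y) ≡⟨ sum-cong-≗ (∑-𝟙-≟ {v}) ⟩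
      ∑[ x < v ] 1                    ≡⟨ ∑-const v 1 ⟩
      v * 1                           ≡⟨ *-identityʳ v ⟩
      v                               ∎

∑∑-by-value : ∀ {v} {P : Fin v → Fin v → Set} (P? : ∀ x y → Dec (P x y)) (d : Fin v → Fin v → Fin n) →
              ∑[ x < v ] ∑[ y < v ] 𝟙 (P? x y) ≡ ∑[ g < n ] ∑[ x < v ] ∑[ y < v ] 𝟙 (P? x y ×-dec (d x y ≟ g))
∑∑-by-value {n} {v} P? d = begin
  ∑[ x < v ] ∑[ y < v ] 𝟙 (P? x y)
    ≡⟨ sum-cong-≗ (λ x → sum-cong-≗ (λ y → split x y)) ⟩
  ∑[ x < v ] ∑[ y < v ] ∑[ g < n ] 𝟙 (P? x y ×-dec (d x y ≟ g))
    ≡⟨ sum-cong-≗ (λ x → ∑-comm (λ y g → 𝟙 (P? x y ×-dec (d x y ≟ g)))) ⟩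
  ∑[ x < v ] ∑[ g < n ] ∑[ y < v ] 𝟙 (P? x y ×-dec (d x y ≟ g))
    ≡⟨ ∑-comm (λ x g → ∑[ y < v ] 𝟙 (P? x y ×-dec (d x y ≟ g))) ⟩
  ∑[ g < n ] ∑[ x < v ] ∑[ y < v ] 𝟙 (P? x y ×-dec (d x y ≟ g)) ∎
  where
  open ≡-Reasoning
  split : ∀ x y → 𝟙 (P? x y) ≡ ∑[ g < n ] 𝟙 (P? x y ×-dec (d x y ≟ g))
  split x y = begin
    𝟙 (P? x y)                               ≡⟨ *-identityʳ (𝟙 (P? x y)) ⟨
    𝟙 (P? x y) * 1                           ≡⟨ cong (𝟙 (P? x y) *_) (∑-𝟙-≟ (d x y)) ⟨
    𝟙 (P? x y) * ∑[ g < n ] 𝟙 (d x y ≟ g)    ≡⟨ *-distribˡ-sum (𝟙 (P? x y)) (λ g → 𝟙 (d x y ≟ g)) ⟩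
    ∑[ g < n ] (𝟙 (P? x y) * 𝟙 (d x y ≟ g))  ≡⟨ sum-cong-≗ (λ g → 𝟙-× (P? x y) (d x y ≟ g)) ⟨
    ∑[ g < n ] 𝟙 (P? x y ×-dec (d x y ≟ g))  ∎

-- Block sizes of a partitioned difference family

module _ {v t} {G : FinGroup v} {k : Fin t → ℕ} {λ' : ℕ} {blk : Fin v → Fin t}
         (pdf : IsPDF G t k λ' blk) where
  open FinGroup G
  open IsPDF pdf

  private
    group : Group 0ℓ 0ℓ
    group = record { isGroup = isGroup }

  internal? : ∀ x y → Dec (x ≢ y × blk x ≡ blk y)
  internal? x y = ¬? (x ≟ y) ×-dec (blk x ≟ blk y)

  #internal : ℕ
  #internal = ∑[ x < v ] ∑[ y < v ] 𝟙 (internal? x y)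

  #internal-with-difference : Fin v → ℕ
  #internal-with-difference g = ∑[ x < v ] ∑[ y < v ] 𝟙 (internal? x y ×-dec (x ⊝ y ≟ g))

  #internal-with-difference-𝟘 : #internal-with-difference 𝟘 ≡ 0
  #internal-with-difference-𝟘 =
    trans (sum-cong-≗ (λ x → sum-cong-≗ (λ y → 𝟙-no (internal? x y ×-dec (x ⊝ y ≟ 𝟘)) (no-zero-difference x y))))
          (trans (sum-cong-≗ {v} (λ _ → ∑-0 v)) (∑-0 v))
    where
    no-zero-difference : ∀ x y → ¬ ((x ≢ y × blk x ≡ blk y) × x ⊝ y ≡ 𝟘)
    no-zero-difference x y ((x≢y , _) , x⊝y≡𝟘) = x≢y (x∙y⁻¹≈ε⇒x≈y group x y x⊝y≡𝟘)

  #internal-with-difference-≢𝟘 : ∀ g → g ≢ 𝟘 → #internal-with-difference g ≡ λ'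
  #internal-with-difference-≢𝟘 g g≢𝟘 =
    trans (sym (count₂≡∑∑𝟙 (λ p → internal? (proj₁ p) (proj₂ p) ×-dec (proj₁ p ⊝ proj₂ p ≟ g)))) (diffs g g≢𝟘)

  #internal+λ≡v*λ : #internal + λ' ≡ v * λ'
  #internal+λ≡v*λ = trans (cong (_+ λ') (∑∑-by-value internal? _⊝_))
                          (∑-const-except-zero-at 𝟘 #internal-with-difference
                             #internal-with-difference-𝟘 #internal-with-difference-≢𝟘)

  size≡∑𝟙 : ∀ i → k i ≡ ∑[ x < v ] 𝟙 (blk x ≟ i)
  size≡∑𝟙 i = trans (sym (sizes i)) (count≡∑𝟙 (λ x → blk x ≟ i))

  ∑-sizes : ∑[ i < t ] k i ≡ v
  ∑-sizes = trans (sum-cong-≗ size≡∑𝟙) (∑-fibres blk)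

  ∑-sizes² : ∑[ i < t ] (k i * k i) ≡ #internal + v
  ∑-sizes² = begin
    ∑[ i < t ] (k i * k i)
      ≡⟨ sum-cong-≗ (λ i → cong₂ _*_ (size≡∑𝟙 i) (size≡∑𝟙 i)) ⟩
    ∑[ i < t ] (∑[ x < v ] 𝟙 (blk x ≟ i) * ∑[ y < v ] 𝟙 (blk y ≟ i))
      ≡⟨ ∑-fibres² blk ⟩
    ∑[ x < v ] ∑[ y < v ] 𝟙 (blk x ≟ blk y)
      ≡⟨ ∑∑-same-image blk ⟩
    #internal + v ∎
    where open ≡-Reasoning

  ∑-sizes²+λ : ∑[ i < t ] (k i * k i) + λ' ≡ v * λ' + v
  ∑-sizes²+λ = begin
    ∑[ i < t ] (k i * k i) + λ' ≡⟨ cong (_+ λ') ∑-sizes² ⟩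
    #internal + v + λ'          ≡⟨ swap #internal v λ' ⟩
    #internal + λ' + v          ≡⟨ cong (_+ v) #internal+λ≡v*λ ⟩
    v * λ' + v                  ∎
    where
    open ≡-Reasoning
    swap : ∀ a b c → a + b + c ≡ a + c + b
    swap = solve-∀

hadamard-∑-sizes² : ∀ {v t} {k : Fin t → ℕ} {λ'} → HPDF v t k λ' → 2 * ∑[ i < t ] (k i * k i) ≡ v * v + v
hadamard-∑-sizes² {t = t} {k} {λ'} ((_ , _ , pdf) , refl) = +-cancelʳ-≡ (2 * λ') _ _ (begin
  2 * S + 2 * λ'                      ≡⟨ *-distribˡ-+ 2 S λ' ⟨
  2 * (S + λ')                        ≡⟨ cong (2 *_) (∑-sizes²+λ pdf) ⟩
  2 * (2 * λ' * λ' + 2 * λ')          ≡⟨ regroup λ' ⟩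
  2 * λ' * (2 * λ') + 2 * λ' + 2 * λ' ∎)
  where
  open ≡-Reasoning
  S = ∑[ i < t ] (k i * k i)
  regroup : ∀ l → 2 * (2 * l * l + 2 * l) ≡ 2 * l * (2 * l) + 2 * l + 2 * l
  regroup = solve-∀

hadamard-three-blocks : ∀ {v a b c λ'} → HPDF v 3 (lookup (a ∷ b ∷ c ∷ [])) λ' →
                        2 * (a * a + b * b + c * c) ≡ (a + b + c) * (a + b + c) + (a + b + c)
hadamard-three-blocks {v} {a} {b} {c} hpdf@((_ , _ , pdf) , _) = begin
  2 * (a * a + b * b + c * c)                ≡⟨ reassoc² a b c ⟩
  2 * (a * a + (b * b + (c * c + 0)))        ≡⟨ hadamard-∑-sizes² hpdf ⟩
  v * v + v                                  ≡⟨ cong (λ s → s * s + s) (trans (reassoc a b c) (∑-sizes pdf)) ⟨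
  (a + b + c) * (a + b + c) + (a + b + c)    ∎
  where
  open ≡-Reasoning
  reassoc : ∀ a b c → a + b + c ≡ a + (b + (c + 0))
  reassoc = solve-∀
  reassoc² : ∀ a b c → 2 * (a * a + b * b + c * c) ≡ 2 * (a * a + (b * b + (c * c + 0)))
  reassoc² = solve-∀

-- n is u − c when c ≤ u, and c − u − 1 otherwise.
n²+n+1-of-difference : ∀ u c → ∃[ n ] n * n + n + 1 + (2 * u * c + c) ≡ u * u + c * c + u + 1
n²+n+1-of-difference u c with ≤-<-connex c u
... | inj₁ c≤u = d , subst (λ u → d * d + d + 1 + (2 * u * c + c) ≡ u * u + c * c + u + 1)
                           (m+[n∸m]≡n c≤u) (identity c d)
  where
  d = u ∸ c
  identity : ∀ c d → d * d + d + 1 + (2 * (c + d) * c + c) ≡ (c + d) * (c + d) + c * c + (c + d) + 1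
  identity = solve-∀
... | inj₂ u<c = d , subst (λ c → d * d + d + 1 + (2 * u * c + c) ≡ u * u + c * c + u + 1)
                           (m+[n∸m]≡n u<c) (identity u d)
  where
  d = c ∸ suc u
  identity : ∀ u d → d * d + d + 1 + (2 * u * (suc u + d) + (suc u + d)) ≡
                     u * u + (suc u + d) * (suc u + d) + u + 1
  identity = solve-∀

product-of-odds≡n²+n+1 : ∀ a b c → 2 * (a * a + b * b + c * c) ≡ (a + b + c) * (a + b + c) + (a + b + c) →
                         ∃[ n ] n * n + n + 1 ≡ (2 * a + 1) * (2 * b + 1)
product-of-odds≡n²+n+1 a b c squares with n²+n+1-of-difference (a + b) c
... | n , n²+n+1+X≡Y+1 = n , +-cancelʳ-≡ X _ _ (trans n²+n+1+X≡Y+1 (sym product+X≡Y+1))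
  where
  X = 2 * (a + b) * c + c
  Y = (a + b) * (a + b) + c * c + (a + b)
  product+X≡Y+1 : (2 * a + 1) * (2 * b + 1) + X ≡ Y + 1
  product+X≡Y+1 = +-cancelʳ-≡ Y _ _ (begin
    (2 * a + 1) * (2 * b + 1) + X + Y
      ≡⟨ expand₁ a b c ⟩
    (2 * a + 1) * (2 * b + 1) + ((a + b + c) * (a + b + c) + (a + b + c))
      ≡⟨ cong ((2 * a + 1) * (2 * b + 1) +_) squares ⟨
    (2 * a + 1) * (2 * b + 1) + 2 * (a * a + b * b + c * c)
      ≡⟨ expand₂ a b c ⟩
    Y + 1 + Y ∎)
    where
    open ≡-Reasoning
    expand₁ : ∀ a b c → (2 * a + 1) * (2 * b + 1) + (2 * (a + b) * c + c) + ((a + b) * (a + b) + c * c + (a + b)) ≡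
                        (2 * a + 1) * (2 * b + 1) + ((a + b + c) * (a + b + c) + (a + b + c))
    expand₁ = solve-∀
    expand₂ : ∀ a b c → (2 * a + 1) * (2 * b + 1) + 2 * (a * a + b * b + c * c) ≡
                        (a + b) * (a + b) + c * c + (a + b) + 1 + ((a + b) * (a + b) + c * c + (a + b))
    expand₂ = solve-∀

p∣[2a+1][2b+1]⇒p%6≢5 :
  ∀ a b c → 2 * (a * a + b * b + c * c) ≡ (a + b + c) * (a + b + c) + (a + b + c) →
  ∀ {p} → Prime p → p ∣ (2 * a + 1) * (2 * b + 1) → p % 6 ≢ 5
p∣[2a+1][2b+1]⇒p%6≢5 a b c squares {p} p-prime p∣ab with product-of-odds≡n²+n+1 a b c squares
... | n , n²+n+1≡ab = p∣n²+n+1⇒p%6≢5 {n = n} p-prime (subst (p ∣_) (sym n²+n+1≡ab) p∣ab)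

p∣[2a+1][2b+1][2c+1]⇒p%6≢5 :
  ∀ a b c → 2 * (a * a + b * b + c * c) ≡ (a + b + c) * (a + b + c) + (a + b + c) →
  ∀ {p} → Prime p → p ∣ (2 * a + 1) * (2 * b + 1) * (2 * c + 1) → p % 6 ≢ 5
p∣[2a+1][2b+1][2c+1]⇒p%6≢5 a b c squares p-prime p∣abc
  with euclidsLemma ((2 * a + 1) * (2 * b + 1)) (2 * c + 1) p-prime p∣abc
... | inj₁ p∣ab = p∣[2a+1][2b+1]⇒p%6≢5 a b c squares p-prime p∣ab
... | inj₂ p∣c  = p∣[2a+1][2b+1]⇒p%6≢5 a c b (trans (swap₁ a b c) (trans squares (swap₂ a b c))) p-prime
                    (∣n⇒∣m*n (2 * a + 1) p∣c)
  where
  swap₁ : ∀ a b c → 2 * (a * a + c * c + b * b) ≡ 2 * (a * a + b * b + c * c)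
  swap₁ = solve-∀
  swap₂ : ∀ a b c → (a + b + c) * (a + b + c) + (a + b + c) ≡ (a + c + b) * (a + c + b) + (a + c + b)
  swap₂ = solve-∀

corollary3p3 : (v k₁ k₂ k₃ λ' : ℕ) →
    HPDF v 3 (lookup (k₁ ∷ k₂ ∷ k₃ ∷ [])) λ' →
    ∀ (p : ℕ) → Prime p → p ∣ ((2 * k₁ + 1) * (2 * k₂ + 1) * (2 * k₃ + 1)) →
    p % 6 ≢ 5
corollary3p3 v k₁ k₂ k₃ λ' hpdf p =
  p∣[2a+1][2b+1][2c+1]⇒p%6≢5 k₁ k₂ k₃ (hadamard-three-blocks hpdf)
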